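{- Let $M$ be a model over a countably infinite set $D$. If there exist a bijection $\pi:\mathbb N\to D$ and a model $M'\subsetneq M$ with $M'\succsim_\pi\mathrm{Rec}$, then $M$ is hypercomputational.
   Context: A model of computation over a set $X$ is any set of functions $f:X\to X\cup\{\bot\}$, where $\bot$ denotes "undefined". $\mathrm{Rec}$ is the model over $\mathbb N$ of all total recursive functions $\mathbb N\to\mathbb N$. Injections are extended by $\rho(\bot)=\bot$. $A\succsim_\rho B$ means: for every $g\in B$ there is $f\in A$ with $\rho\circ g=f\circ\rho$. For an injection $\rho:\mathbb N\to\mathrm{dom}\,M$, $\rho^{ -1}\circ M\circ\rho$ is the set of all functions $g:\mathbb N\to\mathbb N\cup\{\bot\}$ with $\rho\circ g=f\circ\rho$ for some $f\in M$. A model $M$ is hypercomputational if there is an injection $\rho:\mathbb N\to\mathrm{dom}\,M$ such that $\rho^{ -1}\circ M\circ\rho\supsetneq\mathrm{Rec}$. -}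

module Defs where

open import Data.Nat using (ℕ; zero; suc; _<_)
open import Data.Fin using (Fin)
open import Data.Vec using (Vec; []; _∷_; lookup)
open import Data.Maybe using (Maybe; just; nothing)
import Data.Maybe as Maybe
open import Data.Product using (Σ; ∃; _×_; _,_)
open import Relation.Nullary using (¬_)
open import Relation.Binary.PropositionalEquality using (_≡_; _≗_)
open import Function.Definitions using (Injective)

-- A function X → X ∪ {⊥} is represented as X → Maybe X (nothing = ⊥).
-- A model is a *set* of such functions, represented as a predicate that
-- is closed under pointwise (extensional) equality of functions.

PFun : Set → Set
PFun X = X → Maybe X

record Model (X : Set) : Set₁ where
  field
    _∈M : PFun X → Set
    resp : ∀ {f g : PFun X} → f ≗ g → f ∈M → g ∈M
open Model public

_⊆M_ : ∀ {X} → Model X → Model X → Set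
A ⊆M B = ∀ f → (A ∈M) f → (B ∈M) f

_⊊M_ : ∀ {X} → Model X → Model X → Set
A ⊊M B = (A ⊆M B) × (Σ _ λ f → (B ∈M) f × ¬ (A ∈M) f)

Conj : ∀ {X Y : Set} → (ρ : X → Y) → PFun X → PFun Y → Set
Conj ρ g f = ∀ n → Maybe.map ρ (g n) ≡ f (ρ n)

Simulates : ∀ {X Y : Set} → Model Y → (X → Y) → Model X → Set
Simulates A ρ B = ∀ g → (B ∈M) g → Σ _ λ f → (A ∈M) f × Conj ρ g f

data PR : ℕ → Set where
  zer  : ∀ {k} → PR k
  succ : PR 1
  proj : ∀ {k} → Fin k → PR k
  comp : ∀ {k m} → PR m → Vec (PR k) m → PR k
  prec : ∀ {k} → PR k → PR (suc (suc k)) → PR (suc k)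
  mu   : ∀ {k} → PR (suc k) → PR k

data Eval : ∀ {k} → PR k → Vec ℕ k → ℕ → Set
data EvalAll : ∀ {k m} → Vec (PR k) m → Vec ℕ k → Vec ℕ m → Set

data Eval where
  e-zer  : ∀ {k} {xs : Vec ℕ k} → Eval zer xs 0
  e-succ : ∀ {x} → Eval succ (x ∷ []) (suc x)
  e-proj : ∀ {k} {i : Fin k} {xs} → Eval (proj i) xs (lookup xs i)
  e-comp : ∀ {k m} {f : PR m} {gs : Vec (PR k) m} {xs ys y} →
           EvalAll gs xs ys → Eval f ys y → Eval (comp f gs) xs y
  e-prec0 : ∀ {k} {g : PR k} {h} {xs y} →
            Eval g xs y → Eval (prec g h) (0 ∷ xs) y
  e-precS : ∀ {k} {g : PR k} {h} {n xs r y} →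
            Eval (prec g h) (n ∷ xs) r → Eval h (n ∷ r ∷ xs) y →
            Eval (prec g h) (suc n ∷ xs) y
  e-mu   : ∀ {k} {f : PR (suc k)} {xs n} →
           Eval f (n ∷ xs) 0 →
           (∀ i → i < n → ∃ λ m → Eval f (i ∷ xs) (suc m)) →
           Eval (mu f) xs n

data EvalAll where
  [] : ∀ {k} {xs : Vec ℕ k} → EvalAll [] xs []
  _∷_ : ∀ {k m} {g : PR k} {gs : Vec (PR k) m} {xs y ys} →
        Eval g xs y → EvalAll gs xs ys → EvalAll (g ∷ gs) xs (y ∷ ys)

IsTotalRecursive : PFun ℕ → Set
IsTotalRecursive g =
  Σ (PR 1) λ c → ∀ n → ∃ λ m → (g n ≡ just m) × Eval c (n ∷ []) m

Rec : Model ℕ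
Rec = record
  { _∈M = IsTotalRecursive
  ; resp = λ {f} {g} eq (c , h) → c , λ n → let (m , p , e) = h n in
      m , Relation.Binary.PropositionalEquality.trans
            (Relation.Binary.PropositionalEquality.sym (eq n)) p , e
  }

-- ρ⁻¹ ∘ M ∘ ρ  (a model over ℕ)
conjModel : ∀ {X} → Model X → (ℕ → X) → Model ℕ
conjModel M ρ = record
  { _∈M = λ g → Σ _ λ f → (M ∈M) f × Conj ρ g f
  ; resp = λ {g} {g'} eq (f , fM , c) → f , fM , λ n →
      Relation.Binary.PropositionalEquality.trans
        (Relation.Binary.PropositionalEquality.cong (Maybe.map ρ)
          (Relation.Binary.PropositionalEquality.sym (eq n))) (c n)
  }

Hypercomputational : ∀ {X} → Model X → Set
Hypercomputational {X} M =
  Σ (ℕ → X) λ ρ → Injective _≡_ _≡_ ρ × (Rec ⊊M conjModel M ρ)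

-- Take any f ∈ M ∖ M' and pull it back along the bijection π to
-- g = π⁻¹ ∘ f ∘ π.  Then g ∈ π⁻¹ ∘ M ∘ π, but g is not total recursive:
-- otherwise M' would contain some f' with π ∘ g = f' ∘ π, and since π is
-- onto this forces f' ≗ f, so f ∈ M'.  Conversely Rec ⊆ π⁻¹ ∘ M ∘ π is
-- immediate from M' ≿_π Rec and M' ⊆ M.
module Submission where

open import Defs
open import Data.Nat using (ℕ)
open import Data.Product using (Σ; _×_; _,_; proj₁; proj₂)
open import Data.Maybe using (Maybe; just; nothing)
import Data.Maybe as Maybe
open import Relation.Binary.PropositionalEquality
  using (_≡_; _≗_; refl; sym; cong; module ≡-Reasoning)
open import Function.Definitions
  using (Bijective; Surjective; StrictlySurjective; StrictlyInverseˡ)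
open import Function.Consequences using (surjective⇒strictlySurjective)

module _ {X Y : Set} (ρ : X → Y) where

  conj-unique : StrictlySurjective _≡_ ρ →
    ∀ {g f f'} → Conj ρ g f → Conj ρ g f' → f ≗ f'
  conj-unique ρ-onto {g} {f} {f'} c c' y with ρ-onto y
  ... | x , refl = begin
    f (ρ x)              ≡⟨ sym (c x) ⟩
    Maybe.map ρ (g x)    ≡⟨ c' x ⟩
    f' (ρ x)             ∎
    where open ≡-Reasoning

  module _ (ρ⁻¹ : Y → X) (ρ∘ρ⁻¹ : StrictlyInverseˡ _≡_ ρ ρ⁻¹) where

    pullback : PFun Y → PFun X
    pullback f x = Maybe.map ρ⁻¹ (f (ρ x))

    map-ρ∘ρ⁻¹ : ∀ (m : Maybe Y) → Maybe.map ρ (Maybe.map ρ⁻¹ m) ≡ m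
    map-ρ∘ρ⁻¹ nothing  = refl
    map-ρ∘ρ⁻¹ (just y) = cong just (ρ∘ρ⁻¹ y)

    conj-pullback : ∀ f → Conj ρ (pullback f) f
    conj-pullback f x = map-ρ∘ρ⁻¹ (f (ρ x))

module _ {D : Set} (M M' : Model D) {π : ℕ → D} where

  simulated⊆conjModel : ∀ {B} → M' ⊆M M → Simulates M' π B → B ⊆M conjModel M π
  simulated⊆conjModel M'⊆M sim g g∈Rec with sim g g∈Rec
  ... | f , f∈M' , c = f , M'⊆M f f∈M' , c

  simulated⇒∈M' : ∀ {B} → StrictlySurjective _≡_ π → Simulates M' π B →
    ∀ g {f} → (B ∈M) g → Conj π g f → (M' ∈M) f
  simulated⇒∈M' π-onto sim g g∈Rec c with sim g g∈Rec
  ... | f' , f'∈M' , c' = resp M' (conj-unique π π-onto {g} c' c) f'∈M'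

  Rec⊊conjModel : Surjective _≡_ _≡_ π → M' ⊊M M → Simulates M' π Rec →
    Rec ⊊M conjModel M π
  Rec⊊conjModel π-onto (M'⊆M , f , f∈M , f∉M') sim =
      simulated⊆conjModel {B = Rec} M'⊆M sim
    , g
    , (f , f∈M , g~f)
    , λ g∈Rec → f∉M' (simulated⇒∈M' {B = Rec} π-onto′ sim g g∈Rec g~f)
    where
    π-onto′ : StrictlySurjective _≡_ π
    π-onto′ = surjective⇒strictlySurjective _≡_ refl π-onto
    π⁻¹ : D → ℕ
    π⁻¹ d = proj₁ (π-onto′ d)
    π∘π⁻¹ : StrictlyInverseˡ _≡_ π π⁻¹
    π∘π⁻¹ d = proj₂ (π-onto′ d)
    g : PFun ℕ
    g = pullback π π⁻¹ π∘π⁻¹ f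
    g~f : Conj π g f
    g~f = conj-pullback π π⁻¹ π∘π⁻¹ f

mainTheorem20 : (D : Set) → (M : Model D) →
    Σ (ℕ → D) (λ π → Bijective _≡_ _≡_ π ×
    Σ (Model D) (λ M' → (M' ⊊M M) × Simulates M' π Rec)) →
    Hypercomputational M
mainTheorem20 D M (π , (π-injective , π-onto) , M' , M'⊊M , sim) =
  π , π-injective , Rec⊊conjModel M M' π-onto M'⊊M sim
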